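{- Let $R$ be a finite nonzero commutative ring of cardinality $q$, and for $n\ge1$ let $e_n$ be the number of zero dense vectors in $R^n$. Let $b=4q-3$, $\alpha=\frac{1+\sqrt b}{2}$, $\beta=\frac{1-\sqrt b}{2}$. Then for all $n\ge1$, $$e_n=\frac{\alpha^{n+2}-\beta^{n+2}}{\sqrt b}.$$
   Context: A vector $(v_0,\dots,v_{n-1})\in R^n$ is zero dense if it contains no two consecutive nonzero coordinates, i.e. for all $0\le i\le n-2$, $v_i=0$ or $v_{i+1}=0$. -}

module Defs where

open import Level using (Level)
open import Data.Nat as ℕ using (ℕ; zero; suc; _∸_)
open import Data.Fin using (Fin)
open import Data.Fin.Properties as FinP using ()
open import Data.List using (List; []; _∷_; concatMap; map; filter; length; allFin)
open import Data.Vec using (Vec; []; _∷_)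
import Data.Vec as Vec
open import Data.Product using (_×_; _,_; proj₁; proj₂)
open import Data.Sum using (_⊎_; inj₁; inj₂)
open import Data.Unit using (⊤; tt)
open import Data.Integer using (+_)
open import Data.Rational as ℚ using (ℚ; ½; -½; 0ℚ; 1ℚ)
open import Algebra.Bundles using (CommutativeRing)
open import Function.Bundles using (Bijection)
open import Relation.Nullary using (Dec; yes; no; ¬_)
open import Relation.Nullary.Decidable using (_⊎-dec_)
open import Relation.Binary.PropositionalEquality as ≡ using (_≡_)

module _ {c ℓ : Level} (R : CommutativeRing c ℓ) where
  open CommutativeRing R

  ZeroDense : ∀ {n} → Vec Carrier n → Set ℓ
  ZeroDense [] = Level.Lift ℓ ⊤
  ZeroDense (x ∷ []) = Level.Lift ℓ ⊤
  ZeroDense (x ∷ y ∷ v) = ((x ≈ 0#) ⊎ (y ≈ 0#)) × ZeroDense (y ∷ v)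

  CardIs : ℕ → Set (c Level.⊔ ℓ)
  CardIs q = Bijection (≡.setoid (Fin q)) setoid

  module Count {q : ℕ} (card : CardIs q) where
    open Bijection card

    decZero : (x : Carrier) → Dec (x ≈ 0#)
    decZero x with strictlySurjective x | strictlySurjective 0#
    ... | i , fi≈x | j , fj≈0 with i FinP.≟ j
    ... | yes ≡.refl = yes (trans (sym fi≈x) fj≈0)
    ... | no i≢j = no λ x≈0 → i≢j (injective (trans fi≈x (trans x≈0 (sym fj≈0))))

    zeroDense? : ∀ {n} (v : Vec Carrier n) → Dec (ZeroDense v)
    zeroDense? [] = yes (Level.lift tt)
    zeroDense? (x ∷ []) = yes (Level.lift tt)
    zeroDense? (x ∷ y ∷ v) with decZero x ⊎-dec decZero y | zeroDense? (y ∷ v)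
    ... | yes p | yes r = yes (p , r)
    ... | no ¬p | _ = no λ z → ¬p (proj₁ z)
    ... | _ | no ¬r = no λ z → ¬r (proj₂ z)

    -- all vectors in R^n (one representative per element, via the bijection)
    allVecs : (n : ℕ) → List (Vec Carrier n)
    allVecs zero = [] ∷ []
    allVecs (suc n) = concatMap (λ i → map (to i ∷_) (allVecs n)) (allFin q)

    e : ℕ → ℕ
    e n = length (filter zeroDense? (allVecs n))

-- ℚ(√b) represented formally as pairs (a , c) meaning a + c·√b,
-- with multiplication using (√b)² = b.
ℚ√ : Set
ℚ√ = ℚ × ℚ

module _ (b : ℚ) where
  _*√_ : ℚ√ → ℚ√ → ℚ√
  (a , c) *√ (a' , c') = (a ℚ.* a' ℚ.+ b ℚ.* (c ℚ.* c')) , (a ℚ.* c' ℚ.+ c ℚ.* a')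

  _^√_ : ℚ√ → ℕ → ℚ√
  x ^√ zero = 1ℚ , 0ℚ
  x ^√ suc n = x *√ (x ^√ n)

_-√_ : ℚ√ → ℚ√ → ℚ√
(a , c) -√ (a' , c') = (a ℚ.- a') , (c ℚ.- c')

α β : ℚ√
α = ½ , ½
β = ½ , -½

bOf : ℕ → ℚ
bOf q = (+ (4 ℕ.* q ∸ 3)) ℚ./ 1

times√b : ℕ → ℚ√
times√b m = 0ℚ , ((+ m) ℚ./ 1)

-- Splitting a vector of length n + 1 by its first entry shows that the zero
-- dense vectors satisfy e (n + 2) = e (n + 1) + (q − 1) e n with e 0 = 1 and
-- e 1 = q, so e n is the Lucas sequence U (n + 2) of X² − X − (q − 1).
-- Its roots are α and β in ℚ(√b), b = 4q − 3 being the discriminant, and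
-- α^k − β^k solves the same recurrence with the initial values 0 and √b.

module Submission where

open import Defs
open import Level using (Level; Lift; lift)
open import Data.Nat using (ℕ; zero; suc; _≥_; _+_; _*_; _∸_)
import Data.Nat.Properties as ℕP
open import Data.Nat.ListAction using (sum)
import Data.Integer as ℤ
import Data.Integer.Properties as ℤP
open import Data.Rational as ℚ using (ℚ; 0ℚ; 1ℚ; ½; -½; toℚᵘ)
import Data.Rational.Properties as ℚP
open import Data.Rational.Unnormalised as ℚᵘ using (mkℚᵘ; *≡*)
import Data.Rational.Unnormalised.Properties as ℚᵘP
open import Data.Rational.Solver using (module +-*-Solver)
open import Data.Fin using (Fin)
open import Data.List using (List; []; _∷_; _++_; concatMap; map; filter; length; tabulate; allFin)
open import Data.List.Properties using (filter-++; length-++; filter-≐; filter-none; map-tabulate; tabulate-cong)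
import Data.List.Relation.Unary.All as All
open import Data.Vec using (Vec; []; _∷_)
open import Data.Product using (_×_; _,_; proj₁; proj₂)
open import Data.Sum using (_⊎_; inj₁; inj₂)
open import Data.Unit using (⊤; tt)
open import Algebra.Bundles using (CommutativeRing)
open import Algebra.Properties.CommutativeSemigroup ℕP.+-commutativeSemigroup using (x∙yz≈y∙xz)
open import Function using (_∘_)
open import Function.Bundles using (Bijection)
open import Relation.Nullary using (¬_; yes; no; contradiction)
open import Relation.Unary using (Pred; Decidable; _≐_; _∩_)
open import Relation.Unary.Properties using (_∩?_)
open import Relation.Binary.PropositionalEquality

module _ {a} {A : Set a} (step : A → A → A) where

  Recurrent : (ℕ → A) → Set a
  Recurrent u = ∀ k → u (suc (suc k)) ≡ step (u (suc k)) (u k)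

  recurrent-unique : ∀ {u v} → Recurrent u → Recurrent v →
                     u 0 ≡ v 0 → u 1 ≡ v 1 → ∀ k → u k ≡ v k
  recurrent-unique {u} {v} rec-u rec-v u₀ u₁ k = proj₁ (consecutive k)
    where
    open ≡-Reasoning
    consecutive : ∀ k → u k ≡ v k × u (suc k) ≡ v (suc k)
    consecutive zero    = u₀ , u₁
    consecutive (suc k) with uₖ , uₖ₊₁ ← consecutive k = uₖ₊₁ , (begin
      u (suc (suc k))         ≡⟨ rec-u k ⟩
      step (u (suc k)) (u k)  ≡⟨ cong₂ step uₖ₊₁ uₖ ⟩
      step (v (suc k)) (v k)  ≡⟨ rec-v k ⟨
      v (suc (suc k))         ∎)

lucasStep : ℕ → ℕ → ℕ → ℕ
lucasStep r x y = x + r * y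

lucas : ℕ → ℕ → ℕ
lucas r zero          = 0
lucas r (suc zero)    = 1
lucas r (suc (suc k)) = lucasStep r (lucas r (suc k)) (lucas r k)

sum-tabulate-const : ∀ {m} {f : Fin m → ℕ} {B} → (∀ i → f i ≡ B) →
                     sum (tabulate f) ≡ m * B
sum-tabulate-const {zero}  f≡B = refl
sum-tabulate-const {suc m} f≡B = cong₂ _+_ (f≡B Fin.zero) (sum-tabulate-const (f≡B ∘ Fin.suc))

sum-tabulate-pointed : ∀ {m} (j : Fin (suc m)) {f : Fin (suc m) → ℕ} {A B} →
                       f j ≡ A → (∀ i → i ≢ j → f i ≡ B) →
                       sum (tabulate f) ≡ A + m * B
sum-tabulate-pointed Fin.zero fj≡A f≡B =
  cong₂ _+_ fj≡A (sum-tabulate-const (λ i → f≡B (Fin.suc i) λ ()))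
sum-tabulate-pointed {suc m} (Fin.suc j) {f} {A} {B} fj≡A f≡B = begin
  f Fin.zero + sum (tabulate (λ i → f (Fin.suc i)))  ≡⟨ cong₂ _+_ (f≡B Fin.zero λ ()) tail-sum ⟩
  B + (A + m * B)                                    ≡⟨ x∙yz≈y∙xz B A (m * B) ⟩
  A + suc m * B                                      ∎
  where
  open ≡-Reasoning
  tail-sum : sum (tabulate (λ i → f (Fin.suc i))) ≡ A + m * B
  tail-sum = sum-tabulate-pointed j fj≡A (λ i i≢j → f≡B (Fin.suc i) (λ { refl → i≢j refl }))

module _ {a p} {A : Set a} {P : Pred A p} (P? : Decidable P) where

  length-filter-map : ∀ {b} {B : Set b} (f : B → A) xs →
                      length (filter P? (map f xs)) ≡ length (filter (λ x → P? (f x)) xs)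
  length-filter-map f []       = refl
  length-filter-map f (x ∷ xs) with P? (f x)
  ... | yes _ = cong suc (length-filter-map f xs)
  ... | no  _ = length-filter-map f xs

  length-filter-concatMap : ∀ {b} {B : Set b} (f : B → List A) xs →
                            length (filter P? (concatMap f xs))
                              ≡ sum (map (λ x → length (filter P? (f x))) xs)
  length-filter-concatMap f []       = refl
  length-filter-concatMap f (x ∷ xs) = begin
    length (filter P? (f x ++ concatMap f xs))
      ≡⟨ cong length (filter-++ P? (f x) (concatMap f xs)) ⟩
    length (filter P? (f x) ++ filter P? (concatMap f xs))
      ≡⟨ length-++ (filter P? (f x)) ⟩
    length (filter P? (f x)) + length (filter P? (concatMap f xs))
      ≡⟨ cong (length (filter P? (f x)) +_) (length-filter-concatMap f xs) ⟩
    sum (map (λ y → length (filter P? (f y))) (x ∷ xs))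
      ∎
    where open ≡-Reasoning

module _ {c ℓ} (R : CommutativeRing c ℓ) where
  open CommutativeRing R using (Carrier; _≈_; 0#)

  HeadZero : ∀ {n} → Pred (Vec Carrier n) ℓ
  HeadZero []      = Lift ℓ ⊤
  HeadZero (x ∷ _) = x ≈ 0#

  zeroDense-∷⁺ : ∀ {n x} {v : Vec Carrier n} →
                 x ≈ 0# ⊎ HeadZero v → ZeroDense R v → ZeroDense R (x ∷ v)
  zeroDense-∷⁺ {v = []}    _      _  = lift tt
  zeroDense-∷⁺ {v = _ ∷ _} x∨head zd = x∨head , zd

  zeroDense-∷⁻ : ∀ {n x} {v : Vec Carrier n} →
                 ZeroDense R (x ∷ v) → (x ≈ 0# ⊎ HeadZero v) × ZeroDense R v
  zeroDense-∷⁻ {v = []}    _  = inj₂ (lift tt) , lift tt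
  zeroDense-∷⁻ {v = _ ∷ _} zd = zd

module Counting {c ℓ} (R : CommutativeRing c ℓ) {r : ℕ} (card : CardIs R (suc r)) where
  open CommutativeRing R using (Carrier; _≈_; 0#) renaming (trans to ≈-trans; sym to ≈-sym)
  open Bijection card using (to; injective; strictlySurjective)
  open Count R card

  count : ∀ n {P : Pred (Vec Carrier n) ℓ} → Decidable P → ℕ
  count n P? = length (filter P? (allVecs n))

  count-≐ : ∀ n {P Q : Pred (Vec Carrier n) ℓ} (P? : Decidable P) (Q? : Decidable Q) →
            P ≐ Q → count n P? ≡ count n Q?
  count-≐ n P? Q? P≐Q = cong length (filter-≐ P? Q? P≐Q (allVecs n))

  count-∅ : ∀ n {P : Pred (Vec Carrier n) ℓ} (P? : Decidable P) → (∀ v → ¬ P v) → count n P? ≡ 0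
  count-∅ n P? ¬P = cong length (filter-none P? (All.universal ¬P (allVecs n)))

  count-suc : ∀ {n} {P : Pred (Vec Carrier (suc n)) ℓ} (P? : Decidable P) →
              count (suc n) P? ≡ sum (tabulate (λ i → count n (λ v → P? (to i ∷ v))))
  count-suc {n} P? = begin
    length (filter P? (concatMap (λ i → map (to i ∷_) (allVecs n)) (allFin (suc r))))
      ≡⟨ length-filter-concatMap P? (λ i → map (to i ∷_) (allVecs n)) (allFin (suc r)) ⟩
    sum (map (λ i → length (filter P? (map (to i ∷_) (allVecs n)))) (allFin (suc r)))
      ≡⟨ cong sum (map-tabulate (λ i → i) (λ i → length (filter P? (map (to i ∷_) (allVecs n))))) ⟩
    sum (tabulate (λ i → length (filter P? (map (to i ∷_) (allVecs n)))))
      ≡⟨ cong sum (tabulate-cong (λ i → length-filter-map P? (to i ∷_) (allVecs n))) ⟩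
    sum (tabulate (λ i → count n (λ v → P? (to i ∷ v))))
      ∎
    where open ≡-Reasoning

  -- Exactly one of the q candidate first entries is zero.
  count-suc-by-head : ∀ {n} {P : Pred (Vec Carrier (suc n)) ℓ} (P? : Decidable P) {A B} →
                      (∀ {x} → x ≈ 0# → count n (λ v → P? (x ∷ v)) ≡ A) →
                      (∀ {x} → ¬ x ≈ 0# → count n (λ v → P? (x ∷ v)) ≡ B) →
                      count (suc n) P? ≡ A + r * B
  count-suc-by-head P? zero-head nonzero-head =
    trans (count-suc P?)
      (sum-tabulate-pointed zeroIndex (zero-head toZero)
        (λ i i≢zero → nonzero-head (λ toi≈0 → i≢zero (injective (≈-trans toi≈0 (≈-sym toZero))))))
    where
    zeroIndex = proj₁ (strictlySurjective 0#)
    toZero = proj₂ (strictlySurjective 0#)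

  headZero? : ∀ {n} → Decidable (HeadZero R {n})
  headZero? []      = yes (lift tt)
  headZero? (x ∷ _) = decZero x

  eHeadZero : ℕ → ℕ
  eHeadZero n = count n (headZero? ∩? zeroDense?)

  e-suc : ∀ n → e (suc n) ≡ e n + r * eHeadZero n
  e-suc n = count-suc-by-head {n} zeroDense?
    (λ x≈0 → count-≐ n _ zeroDense? (proj₂ ∘ zeroDense-∷⁻ R , zeroDense-∷⁺ R (inj₁ x≈0)))
    (λ x≉0 → count-≐ n _ (headZero? ∩? zeroDense?) (nonzero x≉0 , λ (h , zd) → zeroDense-∷⁺ R (inj₂ h) zd))
    where
    nonzero : ∀ {x} {v : Vec Carrier n} → ¬ x ≈ 0# → ZeroDense R (x ∷ v) → (HeadZero R ∩ ZeroDense R) v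
    nonzero x≉0 zd with zeroDense-∷⁻ R zd
    ... | inj₁ x≈0 , _  = contradiction x≈0 x≉0
    ... | inj₂ h   , zd′ = h , zd′

  eHeadZero-suc : ∀ n → eHeadZero (suc n) ≡ e n
  eHeadZero-suc n = begin
    eHeadZero (suc n)  ≡⟨ split-by-head ⟩
    e n + r * 0        ≡⟨ cong (e n +_) (ℕP.*-zeroʳ r) ⟩
    e n + 0            ≡⟨ ℕP.+-identityʳ (e n) ⟩
    e n                ∎
    where
    open ≡-Reasoning
    split-by-head : eHeadZero (suc n) ≡ e n + r * 0
    split-by-head = count-suc-by-head {n} (headZero? ∩? zeroDense?)
      (λ x≈0 → count-≐ n _ zeroDense?
                 ((λ (_ , zd) → proj₂ (zeroDense-∷⁻ R zd)) , λ zd → x≈0 , zeroDense-∷⁺ R (inj₁ x≈0) zd))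
      (λ x≉0 → count-∅ n _ (λ _ (x≈0 , _) → x≉0 x≈0))

  e-recurrent : Recurrent (lucasStep r) e
  e-recurrent n = trans (e-suc (suc n)) (cong (λ m → e (suc n) + r * m) (eHeadZero-suc n))

  e≡lucas : ∀ n → e n ≡ lucas r (2 + n)
  e≡lucas = recurrent-unique (lucasStep r) e-recurrent (λ k → refl) e-zero e-one
    where
    e-zero : e 0 ≡ lucas r 2
    e-zero = sym (cong suc (ℕP.*-zeroʳ r))
    e-one : e 1 ≡ lucas r 3
    e-one = trans (e-suc 0) (cong (_+ r * 1) e-zero)

fromℕ : ℕ → ℚ
fromℕ m = ℤ.+ m ℚ./ 1

toℚᵘ-fromℕ : ∀ m → toℚᵘ (fromℕ m) ℚᵘ.≃ mkℚᵘ (ℤ.+ m) 0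
toℚᵘ-fromℕ m = ℚP.toℚᵘ-fromℚᵘ (mkℚᵘ (ℤ.+ m) 0)

fromℕ-homo-+ : ∀ a b → fromℕ (a + b) ≡ fromℕ a ℚ.+ fromℕ b
fromℕ-homo-+ a b = ℚP.toℚᵘ-injective (begin
  toℚᵘ (fromℕ (a + b))                ≈⟨ toℚᵘ-fromℕ (a + b) ⟩
  mkℚᵘ (ℤ.+ (a + b)) 0                ≈⟨ *≡* (cong (ℤ._* ℤ.+ 1) numerators) ⟩
  mkℚᵘ (ℤ.+ a) 0 ℚᵘ.+ mkℚᵘ (ℤ.+ b) 0  ≈⟨ ℚᵘP.+-cong (toℚᵘ-fromℕ a) (toℚᵘ-fromℕ b) ⟨
  toℚᵘ (fromℕ a) ℚᵘ.+ toℚᵘ (fromℕ b)  ≈⟨ ℚP.toℚᵘ-homo-+ (fromℕ a) (fromℕ b) ⟨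
  toℚᵘ (fromℕ a ℚ.+ fromℕ b)          ∎)
  where
  open ℚᵘP.≃-Reasoning
  numerators : ℤ.+ (a + b) ≡ ℤ.+ a ℤ.* ℤ.+ 1 ℤ.+ ℤ.+ b ℤ.* ℤ.+ 1
  numerators = trans (ℤP.pos-+ a b) (sym (cong₂ ℤ._+_ (ℤP.*-identityʳ (ℤ.+ a)) (ℤP.*-identityʳ (ℤ.+ b))))

fromℕ-homo-* : ∀ a b → fromℕ (a * b) ≡ fromℕ a ℚ.* fromℕ b
fromℕ-homo-* a b = ℚP.toℚᵘ-injective (begin
  toℚᵘ (fromℕ (a * b))                ≈⟨ toℚᵘ-fromℕ (a * b) ⟩
  mkℚᵘ (ℤ.+ (a * b)) 0                ≈⟨ *≡* (cong (ℤ._* ℤ.+ 1) (ℤP.pos-* a b)) ⟩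
  mkℚᵘ (ℤ.+ a) 0 ℚᵘ.* mkℚᵘ (ℤ.+ b) 0  ≈⟨ ℚᵘP.*-cong (toℚᵘ-fromℕ a) (toℚᵘ-fromℕ b) ⟨
  toℚᵘ (fromℕ a) ℚᵘ.* toℚᵘ (fromℕ b)  ≈⟨ ℚP.toℚᵘ-homo-* (fromℕ a) (fromℕ b) ⟨
  toℚᵘ (fromℕ a ℚ.* fromℕ b)          ∎)
  where open ℚᵘP.≃-Reasoning

_+√_ : ℚ√ → ℚ√ → ℚ√
(a , c) +√ (a′ , c′) = a ℚ.+ a′ , c ℚ.+ c′

_·√_ : ℚ → ℚ√ → ℚ√
s ·√ (a , c) = s ℚ.* a , s ℚ.* c

lucasStep√ : ℚ → ℚ√ → ℚ√ → ℚ√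
lucasStep√ R x y = x +√ (R ·√ y)

discriminant : ℚ → ℚ
discriminant R = fromℕ 4 ℚ.* R ℚ.+ 1ℚ

-√-lucasStep√ : ∀ R x y x′ y′ →
                lucasStep√ R x y -√ lucasStep√ R x′ y′ ≡ lucasStep√ R (x -√ x′) (y -√ y′)
-√-lucasStep√ R (a , c) (a₁ , c₁) (a′ , c′) (a₁′ , c₁′) =
  cong₂ _,_ (linear a a₁ a′ a₁′) (linear c c₁ c′ c₁′)
  where
  open +-*-Solver
  linear : ∀ x y x′ y′ → (x ℚ.+ R ℚ.* y) ℚ.- (x′ ℚ.+ R ℚ.* y′) ≡ (x ℚ.- x′) ℚ.+ R ℚ.* (y ℚ.- y′)
  linear x y x′ y′ = solve 5 (λ x y x′ y′ R → (x :+ R :* y) :- (x′ :+ R :* y′)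
                                              := (x :- x′) :+ R :* (y :- y′)) refl x y x′ y′ R

-√-recurrent : ∀ R {u v} → Recurrent (lucasStep√ R) u → Recurrent (lucasStep√ R) v →
               Recurrent (lucasStep√ R) (λ k → u k -√ v k)
-√-recurrent R {u} {v} rec-u rec-v k =
  trans (cong₂ _-√_ (rec-u k) (rec-v k)) (-√-lucasStep√ R (u (suc k)) (u k) (v (suc k)) (v k))

^√-recurrent : ∀ b R x → (∀ y → _*√_ b x (_*√_ b x y) ≡ lucasStep√ R (_*√_ b x y) y) →
               Recurrent (lucasStep√ R) (_^√_ b x)
^√-recurrent b R x root k = root (_^√_ b x k)

α-root : ∀ R y → _*√_ (discriminant R) α (_*√_ (discriminant R) α y)
                 ≡ lucasStep√ R (_*√_ (discriminant R) α y) y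
α-root R (a , c) = cong₂ _,_
  (solve 3 (λ a c R → con ½ :* (con ½ :* a :+ disc R :* (con ½ :* c)) :+ disc R :* (con ½ :* (con ½ :* c :+ con ½ :* a))
                      := (con ½ :* a :+ disc R :* (con ½ :* c)) :+ R :* a) refl a c R)
  (solve 3 (λ a c R → con ½ :* (con ½ :* c :+ con ½ :* a) :+ con ½ :* (con ½ :* a :+ disc R :* (con ½ :* c))
                      := (con ½ :* c :+ con ½ :* a) :+ R :* c) refl a c R)
  where
  open +-*-Solver
  disc = λ R → con (fromℕ 4) :* R :+ con 1ℚ

β-root : ∀ R y → _*√_ (discriminant R) β (_*√_ (discriminant R) β y)
                 ≡ lucasStep√ R (_*√_ (discriminant R) β y) y
β-root R (a , c) = cong₂ _,_
  (solve 3 (λ a c R → con ½ :* (con ½ :* a :+ disc R :* (con -½ :* c)) :+ disc R :* (con -½ :* (con ½ :* c :+ con -½ :* a))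
                      := (con ½ :* a :+ disc R :* (con -½ :* c)) :+ R :* a) refl a c R)
  (solve 3 (λ a c R → con ½ :* (con ½ :* c :+ con -½ :* a) :+ con -½ :* (con ½ :* a :+ disc R :* (con -½ :* c))
                      := (con ½ :* c :+ con -½ :* a) :+ R :* c) refl a c R)
  where
  open +-*-Solver
  disc = λ R → con (fromℕ 4) :* R :+ con 1ℚ

α¹-β¹ : ∀ b → _^√_ b α 1 -√ _^√_ b β 1 ≡ times√b 1
α¹-β¹ b = cong₂ _,_
  (solve 1 (λ b → (con ½ :* con 1ℚ :+ b :* (con ½ :* con 0ℚ)) :- (con ½ :* con 1ℚ :+ b :* (con -½ :* con 0ℚ))
                  := con 0ℚ) refl b)
  (solve 1 (λ b → (con ½ :* con 0ℚ :+ con ½ :* con 1ℚ) :- (con ½ :* con 0ℚ :+ con -½ :* con 1ℚ)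
                  := con 1ℚ) refl b)
  where open +-*-Solver

times√b-lucas-recurrent : ∀ r → Recurrent (lucasStep√ (fromℕ r)) (times√b ∘ lucas r)
times√b-lucas-recurrent r k = cong₂ _,_
  (sym (trans (ℚP.+-identityˡ _) (ℚP.*-zeroʳ (fromℕ r))))
  (trans (fromℕ-homo-+ (lucas r (suc k)) _) (cong (fromℕ (lucas r (suc k)) ℚ.+_) (fromℕ-homo-* r (lucas r k))))

binet : ∀ r k → let b = discriminant (fromℕ r) in
        _^√_ b α k -√ _^√_ b β k ≡ times√b (lucas r k)
binet r = recurrent-unique (lucasStep√ R)
  (-√-recurrent R {_^√_ b α} {_^√_ b β} (^√-recurrent b R α (α-root R)) (^√-recurrent b R β (β-root R)))
  (times√b-lucas-recurrent r) refl (α¹-β¹ b)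
  where
  R = fromℕ r
  b = discriminant R

bOf-suc : ∀ r → bOf (suc r) ≡ discriminant (fromℕ r)
bOf-suc r = begin
  fromℕ (4 * suc r ∸ 3)   ≡⟨ cong (λ m → fromℕ (m ∸ 3)) (ℕP.*-suc 4 r) ⟩
  fromℕ (1 + 4 * r)       ≡⟨ cong fromℕ (ℕP.+-comm 1 (4 * r)) ⟩
  fromℕ (4 * r + 1)       ≡⟨ fromℕ-homo-+ (4 * r) 1 ⟩
  fromℕ (4 * r) ℚ.+ 1ℚ    ≡⟨ cong (ℚ._+ 1ℚ) (fromℕ-homo-* 4 r) ⟩
  discriminant (fromℕ r)  ∎
  where open ≡-Reasoning

lemma3p11 : {c ℓ : Level} (R : CommutativeRing c ℓ) (q : ℕ) (card : CardIs R q)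
    → ¬ (CommutativeRing._≈_ R (CommutativeRing.1# R) (CommutativeRing.0# R))
    → (n : ℕ) → n ≥ 1
    → _-√_ (_^√_ (bOf q) α (n + 2)) (_^√_ (bOf q) β (n + 2))
    ≡ times√b (Count.e R card n)
lemma3p11 R zero card _ _ _ with Bijection.strictlySurjective card (CommutativeRing.0# R)
... | () , _
lemma3p11 R (suc r) card _ n _ rewrite bOf-suc r = begin
  _^√_ b α (n + 2) -√ _^√_ b β (n + 2)  ≡⟨ binet r (n + 2) ⟩
  times√b (lucas r (n + 2))              ≡⟨ cong (times√b ∘ lucas r) (ℕP.+-comm n 2) ⟩
  times√b (lucas r (2 + n))              ≡⟨ cong times√b (Counting.e≡lucas R card n) ⟨
  times√b (Count.e R card n)             ∎
  where
  open ≡-Reasoning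
  b = discriminant (fromℕ r)
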